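{- Let $\mathcal G=(V,\mathcal E)$ be a graph (loops allowed) such that $\mathcal G^0=\overline{K}_n+\overline{K}_m$ for some $n,m\ge 1$. Then $\mathcal G$ is join-irreducible if and only if each of the two parts $\overline{K}_n$ and $\overline{K}_m$ has either no loops or a loop at every one of its vertices.
   Context: A graph $\mathcal G=(V,\mathcal E)$ has finite vertex set $V=\{1,\dots,n\}$ and $\mathcal E\subseteq[V]^2\cup[V]^1$ (singletons are loops); $\mathcal G^0=(V,\mathcal E\cap[V]^2)$. $\overline{K}_n$ is the edgeless graph on $n$ vertices; the graph join $\mathcal G_1+\mathcal G_2$ is the disjoint union of $\mathcal G_1,\mathcal G_2$ together with all edges between a vertex of $\mathcal G_1$ and a vertex of $\mathcal G_2$ (so $\overline{K}_n+\overline{K}_m$ is the complete bipartite graph with parts of sizes $n,m$). $f_{\mathcal G}$ is the Boolean function computed by the $GF(2)$ polynomial $\sum_{E\in\mathcal E}\prod_{i\in E}x_i$, and $\mathcal G$ is join-irreducible if $f_{\mathcal G}$ is. For Boolean functions, $g\le f$ if there is $\sigma$ with $g(a_1,\dots,a_m)=f(a_{\sigma(1)},\dots,a_{\sigma(n)})$ for all $a_i$; $g<f$ if $g\le f$ and $f\not\le g$; $f$ is join-irreducible if some $f'<f$ satisfies $g\le f'$ for all $g<f$. -}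

module Defs where

open import Data.Nat using (ℕ; zero; suc; _<ᵇ_)
open import Data.Bool using (Bool; true; false; _∧_; _xor_)
open import Data.Fin using (Fin; toℕ) renaming (zero to fzero; suc to fsuc)
open import Data.Fin.Subset using (Subset; _∈_)
open import Data.Product using (Σ; _×_; ∃; ∃-syntax; _,_)
open import Relation.Binary.PropositionalEquality using (_≡_)
open import Relation.Nullary using (¬_)
open import Function using (_∘_)

xorSum : {k : ℕ} → (Fin k → Bool) → Bool
xorSum {zero}  f = false
xorSum {suc k} f = f fzero xor xorSum (f ∘ fsuc)

-- A graph on vertex set Fin N (= {1,…,N}) with loops:
-- loop i  : whether the singleton {i} is an edge,
-- edge i j: whether the 2-set {i,j} is an edge (symmetric, irreflexive).
record Graph (N : ℕ) : Set where
  field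
    loop       : Fin N → Bool
    edge       : Fin N → Fin N → Bool
    edge-sym   : ∀ i j → edge i j ≡ edge j i
    edge-irref : ∀ i → edge i i ≡ false
open Graph public

BoolFun : Set
BoolFun = Σ ℕ (λ n → (Fin n → Bool) → Bool)

-- f_G : the function of the GF(2) polynomial  Σ_{E ∈ 𝓔} Π_{i ∈ E} x_i
fG : {N : ℕ} → Graph N → BoolFun
fG {N} G = N , λ x →
  xorSum (λ i → loop G i ∧ x i)
  xor xorSum (λ i → xorSum (λ j → (toℕ i <ᵇ toℕ j) ∧ edge G i j ∧ x i ∧ x j))

_≤ᶠ_ : BoolFun → BoolFun → Set
(m , g) ≤ᶠ (n , f) = Σ (Fin n → Fin m) λ σ → ∀ (a : Fin m → Bool) → g a ≡ f (a ∘ σ)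

_<ᶠ_ : BoolFun → BoolFun → Set
g <ᶠ f = g ≤ᶠ f × ¬ (f ≤ᶠ g)

JoinIrreducible : BoolFun → Set
JoinIrreducible f = ∃[ f' ] (f' <ᶠ f × (∀ g → g <ᶠ f → g ≤ᶠ f'))

JoinIrreducibleGraph : {N : ℕ} → Graph N → Set
JoinIrreducibleGraph G = JoinIrreducible (fG G)

-- Over GF(2) the function of the complete bipartite graph with parts P, Q and loop vector l is
-- f(x) = (Σ_P x)(Σ_Q x) + Σ l x.  Every proper minor of f factors through an identification
-- minor f[s ≔ t] (x_s := x_t), and f is not below any of them because all its variables are
-- essential.  If the loops are constant on each part, swapping twins shows that every
-- identification minor is below one identifying a vertex of P with a vertex of Q, which is then
-- the largest proper minor.  Otherwise count loops: for a minor all of whose variables except one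
-- are essential, the number of unit vectors it sends to 1 is an invariant, and it equals
-- #loops + 1 − 2[s or t looped] for a cross identification and #loops − 2[s and t looped] for an
-- identification inside a part.  Given any identification f[u ≔ v], some other identification
-- has a different count, so f[u ≔ v] cannot lie above all proper minors.

module Submission where

open import Defs
open import Data.Bool using (Bool; true; false; not; _∧_; _∨_; _xor_)
open import Data.Bool.Properties
  using (not-involutive; not-¬; ¬-not; ∧-comm; ∧-identityʳ; ∧-zeroʳ; ∧-inverseʳ; ∧-idem; ∧-distribˡ-xor;
         xor-comm; xor-same; xor-identityʳ; xor-inverseˡ; xor-annihilates-not)
  renaming (_≟_ to _≟ᵇ_)
open import Data.Bool.Solver using (module xor-∧-Solver)
open import Data.Empty using (⊥; ⊥-elim)
open import Data.Fin using (Fin; _≟_; punchOut; toℕ) renaming (zero to fzero; suc to fsuc)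
open import Data.Fin.Permutation using (permutation)
open import Data.Fin.Permutation.Components using (transpose)
open import Data.Fin.Properties using (suc-injective; any?; ¬∀⟶∃¬; punchOut-injective; injective⇒≤)
open import Data.Fin.Subset using (Subset; ∣_∣; ∁)
open import Data.Fin.Subset.Properties using (nonempty?; Empty-unique; ∣⊥∣≡0)
open import Data.Nat using (ℕ; zero; suc; _+_; _*_; _<ᵇ_; _≤_; _≥_)
import Data.Nat.Properties as ℕ
open import Algebra.Properties.CommutativeMonoid.Sum ℕ.+-0-commutativeMonoid using (sum; sum-cong-≗; sum-permute)
open import Algebra.Properties.CommutativeSemigroup ℕ.+-commutativeSemigroup using (xy∙z≈zy∙x; xy∙z≈xz∙y)
open import Data.Product using (∃; ∃₂; _×_; _,_; proj₁; proj₂)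
open import Data.Sum using (_⊎_; inj₁; inj₂)
open import Data.Vec using (lookup)
open import Data.Vec.Properties using ([]=⇒lookup; lookup-map)
open import Data.Vec.Functional using (updateAt)
open import Data.Vec.Functional.Properties using (updateAt-updates; updateAt-minimal)
open import Function using (_∘_; id; const; case_of_)
open import Function.Bundles using (_⇔_; mk⇔)
open import Function.Definitions using (Injective)
open import Relation.Binary.Bundles using (Preorder)
open import Relation.Binary.Core using (_Preserves_⟶_)
open import Relation.Binary.PropositionalEquality
  using (_≡_; _≢_; _≗_; refl; sym; trans; cong; cong₂; subst; isEquivalence; module ≡-Reasoning)
import Relation.Binary.Reasoning.Preorder as PreorderReasoning
open import Relation.Nullary using (Dec; yes; no; ¬_; ¬?; _×-dec_)
open import Relation.Nullary.Decidable using (does; dec-true; dec-false; decidable-stable)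

open xor-∧-Solver using (solve; _:+_; _:*_; _:=_; con)

private
  variable
    N : ℕ

-- Linear algebra over GF(2)

xorSum-cong : {f g : Fin N → Bool} → f ≗ g → xorSum f ≡ xorSum g
xorSum-cong {zero}  f≗g = refl
xorSum-cong {suc N} f≗g = cong₂ _xor_ (f≗g fzero) (xorSum-cong (f≗g ∘ fsuc))

xorSum-xor : (f g : Fin N → Bool) → xorSum (λ x → f x xor g x) ≡ xorSum f xor xorSum g
xorSum-xor {zero}  f g = refl
xorSum-xor {suc N} f g rewrite xorSum-xor (f ∘ fsuc) (g ∘ fsuc) =
  solve 4 (λ f₀ g₀ F G → (f₀ :+ g₀) :+ (F :+ G) := (f₀ :+ F) :+ (g₀ :+ G))
          refl (f fzero) (g fzero) (xorSum (f ∘ fsuc)) (xorSum (g ∘ fsuc))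

xorSum-scale : ∀ b (f : Fin N → Bool) → xorSum (λ x → b ∧ f x) ≡ b ∧ xorSum f
xorSum-scale {zero}  b f = sym (∧-zeroʳ b)
xorSum-scale {suc N} b f rewrite xorSum-scale b (f ∘ fsuc) =
  solve 3 (λ b f₀ F → (b :* f₀) :+ (b :* F) := b :* (f₀ :+ F)) refl b (f fzero) (xorSum (f ∘ fsuc))

δ : Fin N → Fin N → Bool
δ y x = does (x ≟ y)

δ-diag : (y : Fin N) → δ y y ≡ true
δ-diag y = dec-true (y ≟ y) refl

δ-off : {x y : Fin N} → x ≢ y → δ y x ≡ false
δ-off {x = x} {y} x≢y = dec-false (x ≟ y) x≢y

infix 7 _·_

_·_ : (Fin N → Bool) → (Fin N → Bool) → Bool
c · a = xorSum (λ x → c x ∧ a x)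

·-congʳ : (c : Fin N → Bool) {a b : Fin N → Bool} → a ≗ b → c · a ≡ c · b
·-congʳ c a≗b = xorSum-cong (cong (c _ ∧_) ∘ a≗b)

·-comm : (c a : Fin N → Bool) → c · a ≡ a · c
·-comm c a = xorSum-cong (λ x → ∧-comm (c x) (a x))

·-xorʳ : (c u v : Fin N → Bool) → c · (λ x → u x xor v x) ≡ c · u xor c · v
·-xorʳ c u v = trans (xorSum-cong (λ x → ∧-distribˡ-xor (c x) (u x) (v x))) (xorSum-xor (λ x → c x ∧ u x) (λ x → c x ∧ v x))

·-scaleʳ : (c : Fin N → Bool) (b : Bool) (u : Fin N → Bool) → c · (λ x → b ∧ u x) ≡ b ∧ c · u
·-scaleʳ c b u = trans (xorSum-cong (λ x → ∧-swap (c x) b (u x))) (xorSum-scale b (λ x → c x ∧ u x))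
  where
  ∧-swap : ∀ x y z → x ∧ (y ∧ z) ≡ y ∧ (x ∧ z)
  ∧-swap = solve 3 (λ x y z → x :* (y :* z) := y :* (x :* z)) refl

·-zeroʳ : (c : Fin N → Bool) → c · (λ _ → false) ≡ false
·-zeroʳ {zero}  c = refl
·-zeroʳ {suc N} c rewrite ∧-zeroʳ (c fzero) = ·-zeroʳ (c ∘ fsuc)

·-δ : (c : Fin N → Bool) (y : Fin N) → c · δ y ≡ c y
·-δ {suc N} c fzero = begin
  (c fzero ∧ true) xor (c ∘ fsuc) · (λ _ → false)   ≡⟨ cong₂ _xor_ (∧-identityʳ (c fzero)) (·-zeroʳ (c ∘ fsuc)) ⟩
  c fzero xor false                                 ≡⟨ xor-identityʳ (c fzero) ⟩
  c fzero                                           ∎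
  where open ≡-Reasoning
·-δ c (fsuc y) = trans (cong (_xor (c ∘ fsuc) · δ y) (∧-zeroʳ (c fzero))) (·-δ (c ∘ fsuc) y)

·-shift : (c a u : Fin N → Bool) (b : Bool) → c · (λ x → a x xor (b ∧ u x)) ≡ c · a xor (b ∧ c · u)
·-shift c a u b = trans (·-xorʳ c a (λ x → b ∧ u x)) (cong (c · a xor_) (·-scaleʳ c b u))

·-δ-xor : (c : Fin N → Bool) (s t : Fin N) → c · (λ x → δ s x xor δ t x) ≡ c s xor c t
·-δ-xor c s t = trans (·-xorʳ c (δ s) (δ t)) (cong₂ _xor_ (·-δ c s) (·-δ c t))

identify : Fin N → Fin N → Fin N → Fin N
identify s t = updateAt id s (const t)

identify-source : (s t : Fin N) → identify s t s ≡ t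
identify-source s t = updateAt-updates s id

identify-other : {s t x : Fin N} → x ≢ s → identify s t x ≡ x
identify-other {s = s} {x = x} x≢s = updateAt-minimal x s id x≢s

∘identify : (a : Fin N → Bool) (s t : Fin N) → a ∘ identify s t ≗ λ x → a x xor ((a s xor a t) ∧ δ s x)
∘identify a s t x with x ≟ s
... | yes refl rewrite identify-source x t = solve 2 (λ as at → at := as :+ ((as :+ at) :* con true)) refl (a x) (a t)
... | no x≢s   rewrite identify-other {t = t} x≢s = sym (trans (cong (a x xor_) (∧-zeroʳ _)) (xor-identityʳ (a x)))

·-identify : (c a : Fin N → Bool) (s t : Fin N) → c · (a ∘ identify s t) ≡ c · a xor (c s ∧ (a s xor a t))
·-identify c a s t = begin
  c · (a ∘ identify s t)                          ≡⟨ ·-congʳ c (∘identify a s t) ⟩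
  c · (λ x → a x xor ((a s xor a t) ∧ δ s x))     ≡⟨ ·-shift c a (δ s) (a s xor a t) ⟩
  c · a xor ((a s xor a t) ∧ c · δ s)             ≡⟨ cong (λ z → c · a xor ((a s xor a t) ∧ z)) (·-δ c s) ⟩
  c · a xor ((a s xor a t) ∧ c s)                 ≡⟨ cong (c · a xor_) (∧-comm _ (c s)) ⟩
  c · a xor (c s ∧ (a s xor a t))                 ∎
  where open ≡-Reasoning

transpose-left : (i j : Fin N) → transpose i j i ≡ j
transpose-left i j rewrite dec-true (i ≟ i) refl = refl

transpose-right : (i j : Fin N) → transpose i j j ≡ i
transpose-right i j with j ≟ i
... | yes j≡i = j≡i
... | no _ rewrite dec-true (j ≟ j) refl = refl

transpose-other : {i j k : Fin N} → k ≢ i → k ≢ j → transpose i j k ≡ k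
transpose-other {i = i} {j} {k} k≢i k≢j rewrite dec-false (k ≟ i) k≢i | dec-false (k ≟ j) k≢j = refl

transpose-preserves : (c : Fin N → Bool) {x y : Fin N} → c x ≡ c y → ∀ z → c (transpose x y z) ≡ c z
transpose-preserves c {x} {y} cx≡cy z = by-cases (z ≟ x) (z ≟ y)
  where
  by-cases : Dec (z ≡ x) → Dec (z ≡ y) → c (transpose x y z) ≡ c z
  by-cases (yes refl) _          = trans (cong c (transpose-left z y)) (sym cx≡cy)
  by-cases (no _)     (yes refl) = trans (cong c (transpose-right x z)) cx≡cy
  by-cases (no z≢x)   (no z≢y)   = cong c (transpose-other z≢x z≢y)

·-transpose : (c a : Fin N → Bool) {i j : Fin N} → c i ≡ c j → c · (a ∘ transpose i j) ≡ c · a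
·-transpose c a {i} {j} cᵢ≡cⱼ = begin
  c · (a ∘ transpose i j)                                    ≡⟨ ·-congʳ c ∘transpose ⟩
  c · (λ x → a x xor ((a i xor a j) ∧ (δ i x xor δ j x)))     ≡⟨ ·-shift c a _ (a i xor a j) ⟩
  c · a xor ((a i xor a j) ∧ c · (λ x → δ i x xor δ j x))    ≡⟨ cong (λ z → c · a xor ((a i xor a j) ∧ z)) (·-δ-xor c i j) ⟩
  c · a xor ((a i xor a j) ∧ (c i xor c j))                  ≡⟨ cong (λ z → c · a xor ((a i xor a j) ∧ (z xor c j))) cᵢ≡cⱼ ⟩
  c · a xor ((a i xor a j) ∧ (c j xor c j))                  ≡⟨ solve 3 (λ C A c → C :+ (A :* (c :+ c)) := C) refl (c · a) (a i xor a j) (c j) ⟩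
  c · a                                                      ∎
  where
  open ≡-Reasoning
  ∘transpose : a ∘ transpose i j ≗ λ x → a x xor ((a i xor a j) ∧ (δ i x xor δ j x))
  ∘transpose x = by-cases (x ≟ i) (x ≟ j)
    where
    by-cases : Dec (x ≡ i) → Dec (x ≡ j) → a (transpose i j x) ≡ a x xor ((a i xor a j) ∧ (δ i x xor δ j x))
    by-cases (yes refl) (yes refl) rewrite transpose-left x x | δ-diag x =
      solve 1 (λ a → a := a :+ ((a :+ a) :* (con true :+ con true))) refl (a x)
    by-cases (yes refl) (no x≢j) rewrite transpose-left x j | δ-diag x | δ-off x≢j =
      solve 2 (λ ax aj → aj := ax :+ ((ax :+ aj) :* con true)) refl (a x) (a j)
    by-cases (no x≢i) (yes refl) rewrite transpose-right i x | δ-diag x | δ-off x≢i =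
      solve 2 (λ ai ax → ai := ax :+ ((ai :+ ax) :* con true)) refl (a i) (a x)
    by-cases (no x≢i) (no x≢j) rewrite transpose-other x≢i x≢j | δ-off x≢i | δ-off x≢j =
      solve 3 (λ ax ai aj → ax := ax :+ ((ai :+ aj) :* con false)) refl (a x) (a i) (a j)

moveWeight : Fin N → Fin N → (Fin N → Bool) → Fin N → Bool
moveWeight s t c x = c x xor (c s ∧ (δ s x xor δ t x))

moveWeight-· : (s t : Fin N) (c a : Fin N → Bool) → moveWeight s t c · a ≡ c · (a ∘ identify s t)
moveWeight-· s t c a = begin
  moveWeight s t c · a                             ≡⟨ ·-comm (moveWeight s t c) a ⟩
  a · moveWeight s t c                             ≡⟨ ·-shift a c _ (c s) ⟩
  a · c xor (c s ∧ a · (λ x → δ s x xor δ t x))    ≡⟨ cong₂ (λ u v → u xor (c s ∧ v)) (·-comm a c) (·-δ-xor a s t) ⟩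
  c · a xor (c s ∧ (a s xor a t))                  ≡⟨ ·-identify c a s t ⟨
  c · (a ∘ identify s t)                           ∎
  where open ≡-Reasoning

moveWeight-source : {s t : Fin N} (c : Fin N → Bool) → s ≢ t → moveWeight s t c s ≡ false
moveWeight-source {s = s} {t} c s≢t rewrite δ-diag s | δ-off s≢t = solve 1 (λ x → x :+ (x :* con true) := con false) refl (c s)

moveWeight-target : {s t : Fin N} (c : Fin N → Bool) → s ≢ t → moveWeight s t c t ≡ c t xor c s
moveWeight-target {s = s} {t} c s≢t rewrite δ-diag t | δ-off (s≢t ∘ sym) = solve 2 (λ x y → x :+ (y :* con true) := x :+ y) refl (c t) (c s)

moveWeight-other : {s t x : Fin N} (c : Fin N → Bool) → x ≢ s → x ≢ t → moveWeight s t c x ≡ c x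
moveWeight-other {x = x} c x≢s x≢t rewrite δ-off x≢s | δ-off x≢t = solve 2 (λ x y → x :+ (y :* con false) := x) refl (c x) _

-- Quadratic forms and essential variables

quadForm : (c d l : Fin N → Bool) → (Fin N → Bool) → Bool
quadForm c d l a = (c · a ∧ d · a) xor l · a

quadForm-δ : (c d l : Fin N → Bool) (y : Fin N) → quadForm c d l (δ y) ≡ (c y ∧ d y) xor l y
quadForm-δ c d l y = cong₂ _xor_ (cong₂ _∧_ (·-δ c y) (·-δ d y)) (·-δ l y)

quadForm-zero : (c d l : Fin N → Bool) → quadForm c d l (λ _ → false) ≡ false
quadForm-zero c d l rewrite ·-zeroʳ c | ·-zeroʳ l = refl

quadForm-identify : (c d l : Fin N → Bool) (s t : Fin N) (a : Fin N → Bool) →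
  quadForm c d l (a ∘ identify s t) ≡ quadForm (moveWeight s t c) (moveWeight s t d) (moveWeight s t l) a
quadForm-identify c d l s t a = sym (cong₂ _xor_ (cong₂ _∧_ (moveWeight-· s t c a) (moveWeight-· s t d a)) (moveWeight-· s t l a))

toggle : Fin N → (Fin N → Bool) → Fin N → Bool
toggle y a x = a x xor δ y x

quadForm-toggle : (c d l : Fin N → Bool) (y : Fin N) (a : Fin N → Bool) →
  quadForm c d l (toggle y a) xor quadForm c d l a ≡ ((c · a ∧ d y) xor (c y ∧ d · a)) xor quadForm c d l (δ y)
quadForm-toggle c d l y a
  rewrite ·-xorʳ c a (δ y) | ·-xorʳ d a (δ y) | ·-xorʳ l a (δ y) | ·-δ c y | ·-δ d y | ·-δ l y =
  solve 6 (λ C D L cy dy ly → (((C :+ cy) :* (D :+ dy)) :+ (L :+ ly)) :+ ((C :* D) :+ L)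
                           := ((C :* dy) :+ (cy :* D)) :+ ((cy :* dy) :+ ly))
          refl (c · a) (d · a) (l · a) (c y) (d y) (l y)

Essential : ((Fin N → Bool) → Bool) → Fin N → Set
Essential h y = ∃ λ a → h (toggle y a) ≢ h a

differs⇒essential : (h : (Fin N → Bool) → Bool) {y : Fin N} (a : Fin N → Bool) →
  h (toggle y a) xor h a ≡ true → Essential h y
differs⇒essential h a differ = a , λ same → false≢true (trans (sym (xor-same (h a))) (subst (λ z → z xor h a ≡ true) same differ))
  where
  false≢true : false ≢ true
  false≢true ()

essential-resp : {h h′ : (Fin N → Bool) → Bool} {y : Fin N} → (∀ a → h a ≡ h′ a) → Essential h y → Essential h′ y
essential-resp h≡h′ (a , differ) = a , λ same → differ (trans (h≡h′ (toggle _ a)) (trans same (sym (h≡h′ a))))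

quadForm-essential-diag : (c d l : Fin N → Bool) {y : Fin N} → (c y ∧ d y) xor l y ≡ true → Essential (quadForm c d l) y
quadForm-essential-diag c d l {y} diag =
  differs⇒essential (quadForm c d l) (λ _ → false)
    (trans (cong₂ _xor_ (quadForm-δ c d l y) (quadForm-zero c d l)) (trans (xor-identityʳ _) diag))

-- The changes of the form when toggling y at 0 and at δ w differ by the hypothesis.
quadForm-essential-partner : (c d l : Fin N → Bool) {y : Fin N} (w : Fin N) →
  (c w ∧ d y) xor (c y ∧ d w) ≡ true → Essential (quadForm c d l) y
quadForm-essential-partner c d l {y} w det with quadForm c d l (δ y) in Qy
... | true  = quadForm-essential-diag c d l (trans (sym (quadForm-δ c d l y)) Qy)
... | false = differs⇒essential (quadForm c d l) (δ w) (begin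
  quadForm c d l (toggle y (δ w)) xor quadForm c d l (δ w)
    ≡⟨ quadForm-toggle c d l y (δ w) ⟩
  ((c · δ w ∧ d y) xor (c y ∧ d · δ w)) xor quadForm c d l (δ y)
    ≡⟨ cong₂ (λ u v → ((u ∧ d y) xor (c y ∧ v)) xor quadForm c d l (δ y)) (·-δ c w) (·-δ d w) ⟩
  ((c w ∧ d y) xor (c y ∧ d w)) xor quadForm c d l (δ y)
    ≡⟨ cong₂ _xor_ det Qy ⟩
  true
    ∎)
  where open ≡-Reasoning

-- Endomaps of finite sets

injective⇒surjective : ∀ {n} {f : Fin n → Fin n} → Injective _≡_ _≡_ f → ∀ y → ∃ λ x → f x ≡ y
injective⇒surjective {suc n} {f} f-inj y with any? (λ x → f x ≟ y)
... | yes hit = hit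
... | no miss = ⊥-elim (ℕ.<-irrefl refl (injective⇒≤ punchOut∘f-injective))
  where
  y≢f : ∀ x → y ≢ f x
  y≢f x y≡fx = miss (x , sym y≡fx)
  punchOut∘f-injective : Injective _≡_ _≡_ (λ x → punchOut (y≢f x))
  punchOut∘f-injective eq = f-inj (punchOut-injective (y≢f _) (y≢f _) eq)

module _ {n : ℕ} where

  section⇒retraction : {f r : Fin n → Fin n} → (∀ y → f (r y) ≡ y) → ∀ x → r (f x) ≡ x
  section⇒retraction {f} {r} f∘r x with injective⇒surjective r-injective x
    where
    r-injective : Injective _≡_ _≡_ r
    r-injective {a} {b} ra≡rb = trans (sym (f∘r a)) (trans (cong f ra≡rb) (f∘r b))
  ... | z , refl = cong r (f∘r z)

  collision⇒missed-point : {f : Fin n → Fin n} {u v : Fin n} → u ≢ v → f u ≡ f v → ∃ λ y → ∀ x → f x ≢ y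
  collision⇒missed-point {f} {u} {v} u≢v fu≡fv
    with ¬∀⟶∃¬ n (λ y → ∃ λ x → f x ≡ y) (λ y → any? (λ x → f x ≟ y)) not-surjective
    where
    not-surjective : ¬ (∀ y → ∃ λ x → f x ≡ y)
    not-surjective surj = u≢v (begin
      u             ≡⟨ sym (section⇒retraction {f = f} {r} (proj₂ ∘ surj) u) ⟩
      r (f u)       ≡⟨ cong r fu≡fv ⟩
      r (f v)       ≡⟨ section⇒retraction {f = f} {r} (proj₂ ∘ surj) v ⟩
      v             ∎)
      where
      open ≡-Reasoning
      r : Fin n → Fin n
      r = proj₁ ∘ surj
  ... | y , unhit = y , λ x fx≡y → unhit (x , fx≡y)

module _ {n k : ℕ} where

  collision-or-injective : (f : Fin n → Fin k) → (∃₂ λ u v → u ≢ v × f u ≡ f v) ⊎ Injective _≡_ _≡_ f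
  collision-or-injective f with any? (λ u → any? (λ v → ¬? (u ≟ v) ×-dec (f u ≟ f v)))
  ... | yes (u , v , collision) = inj₁ (u , v , collision)
  ... | no none = inj₂ λ {u} {v} fu≡fv → decidable-stable (u ≟ v) (λ u≢v → none (u , v , u≢v , fu≡fv))

  injective⇒retraction : Fin n → {f : Fin n → Fin k} → Injective _≡_ _≡_ f → ∃ λ r → ∀ x → r (f x) ≡ x
  injective⇒retraction default {f} f-inj = r , r∘f
    where
    r : Fin k → Fin n
    r y with any? (λ x → f x ≟ y)
    ... | yes (x , _) = x
    ... | no _        = default
    r∘f : ∀ x → r (f x) ≡ x
    r∘f x with any? (λ x′ → f x′ ≟ f x)
    ... | yes (_ , fx′≡fx) = f-inj fx′≡fx
    ... | no none          = ⊥-elim (none (x , refl))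

-- The minor preorder and identification minors

≤ᶠ-trans : {f g h : BoolFun} → f ≤ᶠ g → g ≤ᶠ h → f ≤ᶠ h
≤ᶠ-trans {_ , _} {_ , _} {_ , _} (σ , f≡gσ) (τ , g≡hτ) = σ ∘ τ , λ a → trans (f≡gσ a) (g≡hτ (a ∘ σ))

≤ᶠ-refl : {f : BoolFun} → f ≤ᶠ f
≤ᶠ-refl {_ , _} = id , λ _ → refl

≤ᶠ-preorder : Preorder _ _ _
≤ᶠ-preorder = record
  { Carrier    = BoolFun
  ; _≈_        = _≡_
  ; _≲_        = _≤ᶠ_
  ; isPreorder = record { isEquivalence = isEquivalence ; reflexive = λ { refl → ≤ᶠ-refl } ; trans = λ {f g h} → ≤ᶠ-trans {f} {g} {h} }
  }

≤ᶠ-respʳ : {g : BoolFun} {n : ℕ} {f f′ : (Fin n → Bool) → Bool} → (∀ a → f a ≡ f′ a) → g ≤ᶠ (n , f) → g ≤ᶠ (n , f′)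
≤ᶠ-respʳ {_ , _} f≡f′ (σ , g≡fσ) = σ , λ a → trans (g≡fσ a) (f≡f′ (a ∘ σ))

≤ᶠ-respˡ : {g : BoolFun} {n : ℕ} {f f′ : (Fin n → Bool) → Bool} → (∀ a → f a ≡ f′ a) → (n , f) ≤ᶠ g → (n , f′) ≤ᶠ g
≤ᶠ-respˡ {_ , _} f≡f′ (σ , f≡gσ) = σ , λ a → trans (sym (f≡f′ a)) (f≡gσ a)

JoinIrreducible-resp : {n : ℕ} {f f′ : (Fin n → Bool) → Bool} → (∀ a → f a ≡ f′ a) →
  JoinIrreducible (n , f) → JoinIrreducible (n , f′)
JoinIrreducible-resp f≡f′ (h , (h≤f , f≰h) , maximal) =
  h , (≤ᶠ-respʳ {h} f≡f′ h≤f , f≰h ∘ ≤ᶠ-respˡ {h} (sym ∘ f≡f′)) ,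
  λ g (g≤f′ , f′≰g) → maximal g (≤ᶠ-respʳ {g} (sym ∘ f≡f′) g≤f′ , f′≰g ∘ ≤ᶠ-respˡ {g} f≡f′)

Ignores : ((Fin N → Bool) → Bool) → Fin N → Set
Ignores h u = ∀ {a b} → (∀ x → x ≢ u → a x ≡ b x) → h a ≡ h b

_[_≔_] : ((Fin N → Bool) → Bool) → Fin N → Fin N → (Fin N → Bool) → Bool
(h [ s ≔ t ]) a = h (a ∘ identify s t)

module _ {N : ℕ} {h : (Fin N → Bool) → Bool} (h-cong : h Preserves _≗_ ⟶ _≡_) where

  identification-swap : {s t : Fin N} → s ≢ t → (N , h [ s ≔ t ]) ≤ᶠ (N , h [ t ≔ s ])
  identification-swap {s} {t} s≢t = transpose s t , λ a → h-cong (cong a ∘ swapped)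
    where
    open ≡-Reasoning
    swapped : ∀ x → identify s t x ≡ transpose s t (identify t s x)
    swapped x = by-cases (x ≟ s) (x ≟ t)
      where
      by-cases : Dec (x ≡ s) → Dec (x ≡ t) → identify s t x ≡ transpose s t (identify t s x)
      by-cases (yes refl) _ = begin
        identify x t x                   ≡⟨ identify-source x t ⟩
        t                                ≡⟨ transpose-left x t ⟨
        transpose x t x                  ≡⟨ cong (transpose x t) (identify-other s≢t) ⟨
        transpose x t (identify t x x)   ∎
      by-cases (no x≢s) (yes refl) = begin
        identify s x x                   ≡⟨ identify-other x≢s ⟩
        x                                ≡⟨ transpose-left s x ⟨
        transpose s x s                  ≡⟨ cong (transpose s x) (identify-source x s) ⟨
        transpose s x (identify x s x)   ∎
      by-cases (no x≢s) (no x≢t) = begin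
        identify s t x                   ≡⟨ identify-other x≢s ⟩
        x                                ≡⟨ transpose-other x≢s x≢t ⟨
        transpose s t x                  ≡⟨ cong (transpose s t) (identify-other x≢t) ⟨
        transpose s t (identify t s x)   ∎

  proper-minor⇒below-identification : {g : BoolFun} → Fin N → g <ᶠ (N , h) → ∃₂ λ s t → s ≢ t × g ≤ᶠ (N , h [ s ≔ t ])
  proper-minor⇒below-identification {_ , _} default ((σ , g≡hσ) , h≰g) with collision-or-injective σ
  ... | inj₁ (u , v , u≢v , σu≡σv) = u , v , u≢v , σ , λ a → trans (g≡hσ a) (h-cong (cong a ∘ σ-absorbs))
    where
    σ-absorbs : ∀ x → σ x ≡ σ (identify u v x)
    σ-absorbs x with x ≟ u
    ... | yes refl = trans σu≡σv (cong σ (sym (identify-source x v)))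
    ... | no x≢u   = cong σ (sym (identify-other x≢u))
  ... | inj₂ σ-injective with injective⇒retraction default σ-injective
  ...   | r , r∘σ = ⊥-elim (h≰g (r , λ a → trans (h-cong (cong a ∘ sym ∘ r∘σ)) (sym (g≡hσ (a ∘ r)))))

  essential⇒not-below-identification : (∀ y → Essential h y) → {s t : Fin N} → s ≢ t → ¬ ((N , h) ≤ᶠ (N , h [ s ≔ t ]))
  essential⇒not-below-identification essential {s} {t} s≢t (σ , h≡hπ) with collision⇒missed-point {f = σ ∘ identify s t} s≢t πs≡πt
    where
    πs≡πt : σ (identify s t s) ≡ σ (identify s t t)
    πs≡πt = cong σ (trans (identify-source s t) (sym (identify-other (s≢t ∘ sym))))
  ... | y , unhit with essential y
  ...   | a , differ = differ (begin
    h (toggle y a)                                   ≡⟨ h≡hπ (toggle y a) ⟩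
    h (toggle y a ∘ σ ∘ identify s t)                ≡⟨ h-cong (λ x → cong (a _ xor_) (δ-off (unhit x))) ⟩
    h ((λ x → a x xor false) ∘ σ ∘ identify s t)    ≡⟨ h-cong (λ x → xor-identityʳ _) ⟩
    h (a ∘ σ ∘ identify s t)                         ≡⟨ sym (h≡hπ a) ⟩
    h a                                              ∎)
    where open ≡-Reasoning

  identification-ignores-source : {u v : Fin N} → u ≢ v → Ignores (h [ u ≔ v ]) u
  identification-ignores-source {u} {v} u≢v a≡b = h-cong λ x → a≡b _ (avoids x)
    where
    avoids : ∀ x → identify u v x ≢ u
    avoids x with x ≟ u
    ... | yes refl = subst (_≢ x) (sym (identify-source x v)) (u≢v ∘ sym)
    ... | no x≢u   = subst (_≢ u) (sym (identify-other x≢u)) x≢u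

-- Counting loops

𝟙 : Bool → ℕ
𝟙 false = 0
𝟙 true  = 1

sum-update : (f g : Fin N → ℕ) (s : Fin N) → (∀ x → x ≢ s → f x ≡ g x) → sum f + g s ≡ sum g + f s
sum-update {suc N} f g fzero f≡g = begin
  f fzero + sum (f ∘ fsuc) + g fzero   ≡⟨ cong (λ z → f fzero + z + g fzero) (sum-cong-≗ (λ x → f≡g (fsuc x) λ ())) ⟩
  f fzero + sum (g ∘ fsuc) + g fzero   ≡⟨ xy∙z≈zy∙x (f fzero) _ _ ⟩
  g fzero + sum (g ∘ fsuc) + f fzero   ∎
  where open ≡-Reasoning
sum-update {suc N} f g (fsuc s) f≡g = begin
  f fzero + sum (f ∘ fsuc) + g (fsuc s)     ≡⟨ ℕ.+-assoc (f fzero) _ _ ⟩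
  f fzero + (sum (f ∘ fsuc) + g (fsuc s))   ≡⟨ cong₂ _+_ (f≡g fzero λ ())
                                                        (sum-update (f ∘ fsuc) (g ∘ fsuc) s λ x x≢s → f≡g (fsuc x) (x≢s ∘ suc-injective)) ⟩
  g fzero + (sum (g ∘ fsuc) + f (fsuc s))   ≡⟨ ℕ.+-assoc (g fzero) _ _ ⟨
  g fzero + sum (g ∘ fsuc) + f (fsuc s)     ∎
  where open ≡-Reasoning

sum-update₂ : (f g : Fin N → ℕ) {s t : Fin N} → s ≢ t → (∀ x → x ≢ s → x ≢ t → f x ≡ g x) →
  sum f + g s + g t ≡ sum g + f s + f t
sum-update₂ f g {s} {t} s≢t f≡g = begin
  sum f + g s + g t   ≡⟨ cong (_+ g t) (trans (cong (sum f +_) (sym m-at-s)) (sum-update f m s λ x x≢s → sym (m-off x≢s))) ⟩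
  sum m + f s + g t   ≡⟨ xy∙z≈xz∙y (sum m) _ _ ⟩
  sum m + g t + f s   ≡⟨ cong (_+ f s) (sum-update m g t m≡g) ⟩
  sum g + m t + f s   ≡⟨ cong (λ z → sum g + z + f s) (m-off (s≢t ∘ sym)) ⟩
  sum g + f t + f s   ≡⟨ xy∙z≈xz∙y (sum g) _ _ ⟩
  sum g + f s + f t   ∎
  where
  open ≡-Reasoning
  m : Fin _ → ℕ
  m = updateAt f s (const (g s))
  m-at-s : m s ≡ g s
  m-at-s = updateAt-updates s f
  m-off : ∀ {x} → x ≢ s → m x ≡ f x
  m-off {x} x≢s = updateAt-minimal x s f x≢s
  m≡g : ∀ x → x ≢ t → m x ≡ g x
  m≡g x x≢t with x ≟ s
  ... | yes refl = m-at-s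
  ... | no x≢s   = trans (m-off x≢s) (f≡g x x≢s x≢t)

-- For the function of a graph, h (δ y) is the loop bit at y.
loopCount : ((Fin N → Bool) → Bool) → ℕ
loopCount h = sum λ y → 𝟙 (h (δ y))

essential⇒hit : {h h′ : (Fin N → Bool) → Bool} (π : Fin N → Fin N) {u y : Fin N} →
  (∀ a → h a ≡ h′ (a ∘ π)) → Ignores h′ u → Essential h y → ∃ λ x → x ≢ u × π x ≡ y
essential⇒hit {h = h} {h′} π {u} {y} h≡h′∘π h′-ignores-u (a , differ)
  with any? (λ x → ¬? (x ≟ u) ×-dec (π x ≟ y))
... | yes hit = hit
... | no none = ⊥-elim (differ (begin
  h (toggle y a)          ≡⟨ h≡h′∘π (toggle y a) ⟩
  h′ (toggle y a ∘ π)     ≡⟨ h′-ignores-u untouched ⟩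
  h′ (a ∘ π)              ≡⟨ h≡h′∘π a ⟨
  h a                     ∎))
  where
  open ≡-Reasoning
  untouched : ∀ x → x ≢ u → toggle y a (π x) ≡ a (π x)
  untouched x x≢u = trans (cong (a (π x) xor_) (δ-off λ πx≡y → none (x , x≢u , πx≡y))) (xor-identityʳ _)

loopCount-invariant : {h h′ : (Fin N → Bool) → Bool} (π : Fin N → Fin N) {s u : Fin N} →
  (∀ a → h a ≡ h′ (a ∘ π)) → Ignores h′ u → (∀ y → y ≢ s → Essential h y) → loopCount h ≡ loopCount h′
loopCount-invariant {N} {h} {h′} π {s} {u} h≡h′∘π h′-ignores-u essential = begin
  sum (λ y → 𝟙 (h (δ y)))         ≡⟨ sum-cong-≗ (cong 𝟙 ∘ relabel) ⟩
  sum (λ y → 𝟙 (h′ (δ (r y))))    ≡⟨ sum-permute (λ y → 𝟙 (h′ (δ y))) (permutation r κ r∘κ κ∘r) ⟨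
  sum (λ y → 𝟙 (h′ (δ y)))        ∎
  where
  open ≡-Reasoning
  -- By essentiality π maps the variables other than u onto those other than s; κ completes
  -- this to a bijection by u ↦ s.
  κ : Fin N → Fin N
  κ = updateAt π u (const s)
  κ-off : ∀ {x} → x ≢ u → κ x ≡ π x
  κ-off {x} x≢u = updateAt-minimal x u π x≢u
  κ-at-u : κ u ≡ s
  κ-at-u = updateAt-updates u π
  κ-surjective : ∀ y → ∃ λ x → κ x ≡ y
  κ-surjective y with y ≟ s
  ... | yes refl = u , κ-at-u
  ... | no y≢s with essential⇒hit π h≡h′∘π h′-ignores-u (essential y y≢s)
  ...   | x , x≢u , πx≡y = x , trans (κ-off x≢u) πx≡y
  r : Fin N → Fin N
  r = proj₁ ∘ κ-surjective
  κ∘r : ∀ y → κ (r y) ≡ y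
  κ∘r = proj₂ ∘ κ-surjective
  r∘κ : ∀ x → r (κ x) ≡ x
  r∘κ = section⇒retraction {f = κ} {r} κ∘r
  δ-pullback : ∀ y x → δ y (κ x) ≡ δ (r y) x
  δ-pullback y x with κ x ≟ y | x ≟ r y
  ... | yes _     | yes _ = refl
  ... | no  _     | no  _ = refl
  ... | yes κx≡y  | no x≢ry = ⊥-elim (x≢ry (trans (sym (r∘κ x)) (cong r κx≡y)))
  ... | no  κx≢y  | yes x≡ry = ⊥-elim (κx≢y (trans (cong κ x≡ry) (κ∘r y)))
  relabel : ∀ y → h (δ y) ≡ h′ (δ (r y))
  relabel y = trans (h≡h′∘π (δ y)) (h′-ignores-u λ x x≢u → trans (cong (δ y) (sym (κ-off x≢u))) (δ-pullback y x))

parity-clash : ∀ {X Y L} a b → X ≡ Y → X + 2 * 𝟙 a ≡ suc L → Y + 2 * 𝟙 b ≡ L → ⊥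
parity-clash {X} a b refl odd even =
  twice≢suc a b (ℕ.+-cancelˡ-≡ X _ _ (trans odd (trans (cong suc (sym even)) (sym (ℕ.+-suc X _)))))
  where
  twice≢suc : ∀ a b → 2 * 𝟙 a ≢ suc (2 * 𝟙 b)
  twice≢suc false false ()
  twice≢suc false true  ()
  twice≢suc true  false ()
  twice≢suc true  true  ()

equal-totals⇒equal-bits : ∀ {X Y L} a b → X ≡ Y → X + 2 * 𝟙 a ≡ L → Y + 2 * 𝟙 b ≡ L → a ≡ b
equal-totals⇒equal-bits {X} a b refl eqa eqb = twice-injective a b (ℕ.+-cancelˡ-≡ X _ _ (trans eqa (sym eqb)))
  where
  twice-injective : ∀ a b → 2 * 𝟙 a ≡ 2 * 𝟙 b → a ≡ b
  twice-injective false false _ = refl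
  twice-injective true  true  _ = refl
  twice-injective false true  ()
  twice-injective true  false ()

-- Complete bipartite graphs with loops

module Bipartite {N : ℕ} (p l : Fin N → Bool) where

  q : Fin N → Bool
  q = not ∘ p

  -- The function of the complete bipartite graph with parts p, q and loops l (see fG-bipartite).
  F : (Fin N → Bool) → Bool
  F = quadForm p q l

  F-cong : F Preserves _≗_ ⟶ _≡_
  F-cong a≗b = cong₂ _xor_ (cong₂ _∧_ (·-congʳ p a≗b) (·-congʳ q a≗b)) (·-congʳ l a≗b)

  opposite⇒distinct : {x y : Fin N} → p y ≡ not (p x) → x ≢ y
  opposite⇒distinct py≡¬px refl = not-¬ refl py≡¬px

  opposite⇒xor : {x y : Fin N} → p y ≡ not (p x) → p y xor p x ≡ true
  opposite⇒xor {x} py≡¬px = trans (cong (_xor p x) py≡¬px) (xor-inverseˡ (p x))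

  opposite-partner : {y w : Fin N} → p w ≡ not (p y) → (p w ∧ q y) xor (p y ∧ q w) ≡ true
  opposite-partner {y} pw≡¬py rewrite pw≡¬py with p y
  ... | false = refl
  ... | true  = refl

  F-essential : {y w : Fin N} → p w ≡ not (p y) → Essential F y
  F-essential {w = w} pw≡¬py = quadForm-essential-partner p q l w (opposite-partner pw≡¬py)

  module _ {s t : Fin N} where

    identified-δ : ∀ y → (F [ s ≔ t ]) (δ y) ≡ (moveWeight s t p y ∧ moveWeight s t q y) xor moveWeight s t l y
    identified-δ y = trans (quadForm-identify p q l s t (δ y)) (quadForm-δ (moveWeight s t p) (moveWeight s t q) (moveWeight s t l) y)

    identified-essential-diag : ∀ {y} → (moveWeight s t p y ∧ moveWeight s t q y) xor moveWeight s t l y ≡ true →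
      Essential (F [ s ≔ t ]) y
    identified-essential-diag diag =
      essential-resp (sym ∘ quadForm-identify p q l s t) (quadForm-essential-diag (moveWeight s t p) (moveWeight s t q) (moveWeight s t l) diag)

    identified-essential-partner : ∀ {y} w → (moveWeight s t p w ∧ moveWeight s t q y) xor (moveWeight s t p y ∧ moveWeight s t q w) ≡ true →
      Essential (F [ s ≔ t ]) y
    identified-essential-partner w det =
      essential-resp (sym ∘ quadForm-identify p q l s t) (quadForm-essential-partner (moveWeight s t p) (moveWeight s t q) (moveWeight s t l) w det)

  cross-identification-essential : {s t : Fin N} → s ≢ t → p t ≡ not (p s) →
    (w : Fin N) → w ≢ s → w ≢ t → ∀ y → y ≢ s → Essential (F [ s ≔ t ]) y
  cross-identification-essential {s} {t} s≢t pₜ≡¬pₛ w w≢s w≢t y y≢s = by-cases (y ≟ t)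
    where
    p-at-t : moveWeight s t p t ≡ true
    p-at-t = trans (moveWeight-target p s≢t) (opposite⇒xor pₜ≡¬pₛ)
    q-at-t : moveWeight s t q t ≡ true
    q-at-t = trans (moveWeight-target q s≢t) (trans (xor-annihilates-not (p t) (p s)) (opposite⇒xor pₜ≡¬pₛ))
    by-cases : Dec (y ≡ t) → Essential (F [ s ≔ t ]) y
    by-cases (yes refl) = identified-essential-partner w det
      where
      det : (moveWeight s y p w ∧ moveWeight s y q y) xor (moveWeight s y p y ∧ moveWeight s y q w) ≡ true
      det rewrite p-at-t | q-at-t | moveWeight-other p w≢s w≢t | moveWeight-other q w≢s w≢t with p w
      ... | false = refl
      ... | true  = refl
    by-cases (no y≢t) = identified-essential-partner t det
      where
      det : (moveWeight s t p t ∧ moveWeight s t q y) xor (moveWeight s t p y ∧ moveWeight s t q t) ≡ true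
      det rewrite p-at-t | q-at-t | moveWeight-other p y≢s y≢t | moveWeight-other q y≢s y≢t with p y
      ... | false = refl
      ... | true  = refl

  within-identification-essential : {s t : Fin N} → s ≢ t → p t ≡ p s → l t ≡ not (l s) →
    (∀ x → p x ≡ not (p s) → l x ≡ true) → {o : Fin N} → p o ≡ not (p s) →
    ∀ y → y ≢ s → Essential (F [ s ≔ t ]) y
  within-identification-essential {s} {t} s≢t pₜ≡pₛ lₜ≡¬lₛ looped {o} pₒ≡¬pₛ y y≢s = by-cases (y ≟ t) (p y ≟ᵇ p s)
    where
    by-cases : Dec (y ≡ t) → Dec (p y ≡ p s) → Essential (F [ s ≔ t ]) y
    by-cases (yes refl) _ = identified-essential-diag diag
      where
      diag : (moveWeight s y p y ∧ moveWeight s y q y) xor moveWeight s y l y ≡ true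
      diag rewrite moveWeight-target p s≢t | moveWeight-target l s≢t | pₜ≡pₛ | xor-same (p s) | lₜ≡¬lₛ = xor-inverseˡ (l s)
    by-cases (no y≢t) (yes pᵧ≡pₛ) = identified-essential-partner o det
      where
      o≢s : o ≢ s
      o≢s = opposite⇒distinct pₒ≡¬pₛ ∘ sym
      o≢t : o ≢ t
      o≢t = opposite⇒distinct (trans pₒ≡¬pₛ (cong not (sym pₜ≡pₛ))) ∘ sym
      det : (moveWeight s t p o ∧ moveWeight s t q y) xor (moveWeight s t p y ∧ moveWeight s t q o) ≡ true
      det rewrite moveWeight-other p o≢s o≢t | moveWeight-other q o≢s o≢t | moveWeight-other p y≢s y≢t | moveWeight-other q y≢s y≢t =
        opposite-partner (trans pₒ≡¬pₛ (cong not (sym pᵧ≡pₛ)))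
    by-cases (no y≢t) (no pᵧ≢pₛ) = identified-essential-diag diag
      where
      diag : (moveWeight s t p y ∧ moveWeight s t q y) xor moveWeight s t l y ≡ true
      diag rewrite moveWeight-other p y≢s y≢t | moveWeight-other q y≢s y≢t | moveWeight-other l y≢s y≢t
                 | ∧-inverseʳ (p y) | looped y (¬-not pᵧ≢pₛ) = refl

  loops : ℕ
  loops = sum (𝟙 ∘ l)

  loopCount-identification : {s t : Fin N} → s ≢ t →
    loopCount (F [ s ≔ t ]) + 𝟙 (l s) + 𝟙 (l t) ≡ loops + 𝟙 ((p t xor p s) xor (l t xor l s))
  loopCount-identification {s} {t} s≢t = begin
    loopCount (F [ s ≔ t ]) + 𝟙 (l s) + 𝟙 (l t)           ≡⟨ sum-update₂ (λ y → 𝟙 ((F [ s ≔ t ]) (δ y))) (𝟙 ∘ l) s≢t unchanged ⟩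
    loops + 𝟙 ((F [ s ≔ t ]) (δ s)) + 𝟙 ((F [ s ≔ t ]) (δ t)) ≡⟨ cong₂ (λ u v → loops + 𝟙 u + 𝟙 v) at-s at-t ⟩
    loops + 0 + 𝟙 ((p t xor p s) xor (l t xor l s))        ≡⟨ cong (_+ _) (ℕ.+-identityʳ loops) ⟩
    loops + 𝟙 ((p t xor p s) xor (l t xor l s))            ∎
    where
    open ≡-Reasoning
    unchanged : ∀ y → y ≢ s → y ≢ t → 𝟙 ((F [ s ≔ t ]) (δ y)) ≡ 𝟙 (l y)
    unchanged y y≢s y≢t = cong 𝟙 (begin
      (F [ s ≔ t ]) (δ y)
        ≡⟨ identified-δ y ⟩
      (moveWeight s t p y ∧ moveWeight s t q y) xor moveWeight s t l y
        ≡⟨ cong₂ (λ a b → (a ∧ b) xor moveWeight s t l y) (moveWeight-other p y≢s y≢t) (moveWeight-other q y≢s y≢t) ⟩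
      (p y ∧ not (p y)) xor moveWeight s t l y
        ≡⟨ cong₂ _xor_ (∧-inverseʳ (p y)) (moveWeight-other l y≢s y≢t) ⟩
      l y
        ∎)
    at-s : (F [ s ≔ t ]) (δ s) ≡ false
    at-s = trans (identified-δ s) (cong₂ (λ a b → (a ∧ moveWeight s t q s) xor b) (moveWeight-source p s≢t) (moveWeight-source l s≢t))
    at-t : (F [ s ≔ t ]) (δ t) ≡ (p t xor p s) xor (l t xor l s)
    at-t = begin
      (F [ s ≔ t ]) (δ t)
        ≡⟨ identified-δ t ⟩
      (moveWeight s t p t ∧ moveWeight s t q t) xor moveWeight s t l t
        ≡⟨ cong₂ _xor_ (cong₂ _∧_ (moveWeight-target p s≢t) (moveWeight-target q s≢t)) (moveWeight-target l s≢t) ⟩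
      ((p t xor p s) ∧ (not (p t) xor not (p s))) xor (l t xor l s)
        ≡⟨ cong (λ b → ((p t xor p s) ∧ b) xor (l t xor l s)) (xor-annihilates-not (p t) (p s)) ⟩
      ((p t xor p s) ∧ (p t xor p s)) xor (l t xor l s)
        ≡⟨ cong (_xor (l t xor l s)) (∧-idem (p t xor p s)) ⟩
      (p t xor p s) xor (l t xor l s)
        ∎

  loopCount-cross : {s t : Fin N} → s ≢ t → p t ≡ not (p s) → loopCount (F [ s ≔ t ]) + 2 * 𝟙 (l s ∨ l t) ≡ suc loops
  loopCount-cross {s} {t} s≢t pₜ≡¬pₛ = ℕ.+-cancelʳ-≡ (𝟙 (not (l t xor l s))) _ _ (begin
    X + 2 * 𝟙 (l s ∨ l t) + 𝟙 (not (l t xor l s))     ≡⟨ ℕ.+-assoc X _ _ ⟩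
    X + (2 * 𝟙 (l s ∨ l t) + 𝟙 (not (l t xor l s)))   ≡⟨ cong (X +_) (indicator-sum (l s) (l t)) ⟩
    X + suc (𝟙 (l s) + 𝟙 (l t))                       ≡⟨ ℕ.+-suc X _ ⟩
    suc (X + (𝟙 (l s) + 𝟙 (l t)))                     ≡⟨ cong suc (ℕ.+-assoc X _ _) ⟨
    suc (X + 𝟙 (l s) + 𝟙 (l t))                       ≡⟨ cong suc (loopCount-identification s≢t) ⟩
    suc (loops + 𝟙 ((p t xor p s) xor (l t xor l s)))  ≡⟨ cong (λ b → suc (loops + 𝟙 (b xor (l t xor l s)))) (opposite⇒xor pₜ≡¬pₛ) ⟩
    suc loops + 𝟙 (not (l t xor l s))                  ∎)
    where
    open ≡-Reasoning
    X : ℕ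
    X = loopCount (F [ s ≔ t ])
    indicator-sum : ∀ a b → 2 * 𝟙 (a ∨ b) + 𝟙 (not (b xor a)) ≡ suc (𝟙 a + 𝟙 b)
    indicator-sum false false = refl
    indicator-sum false true  = refl
    indicator-sum true  false = refl
    indicator-sum true  true  = refl

  loopCount-within : {s t : Fin N} → s ≢ t → p t ≡ p s → loopCount (F [ s ≔ t ]) + 2 * 𝟙 (l s ∧ l t) ≡ loops
  loopCount-within {s} {t} s≢t pₜ≡pₛ = ℕ.+-cancelʳ-≡ (𝟙 (l t xor l s)) _ _ (begin
    X + 2 * 𝟙 (l s ∧ l t) + 𝟙 (l t xor l s)         ≡⟨ ℕ.+-assoc X _ _ ⟩
    X + (2 * 𝟙 (l s ∧ l t) + 𝟙 (l t xor l s))       ≡⟨ cong (X +_) (indicator-sum (l s) (l t)) ⟩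
    X + (𝟙 (l s) + 𝟙 (l t))                         ≡⟨ ℕ.+-assoc X _ _ ⟨
    X + 𝟙 (l s) + 𝟙 (l t)                           ≡⟨ loopCount-identification s≢t ⟩
    loops + 𝟙 ((p t xor p s) xor (l t xor l s))     ≡⟨ cong (λ b → loops + 𝟙 (b xor (l t xor l s))) pₜ⊕pₛ ⟩
    loops + 𝟙 (l t xor l s)                         ∎)
    where
    open ≡-Reasoning
    X : ℕ
    X = loopCount (F [ s ≔ t ])
    pₜ⊕pₛ : p t xor p s ≡ false
    pₜ⊕pₛ = trans (cong (_xor p s) pₜ≡pₛ) (xor-same (p s))
    indicator-sum : ∀ a b → 2 * 𝟙 (a ∧ b) + 𝟙 (b xor a) ≡ 𝟙 a + 𝟙 b
    indicator-sum false false = refl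
    indicator-sum false true  = refl
    indicator-sum true  false = refl
    indicator-sum true  true  = refl

  loopCount-cross≢within : {s t u v : Fin N} → s ≢ t → p t ≡ not (p s) → u ≢ v → p v ≡ p u →
    loopCount (F [ s ≔ t ]) ≢ loopCount (F [ u ≔ v ])
  loopCount-cross≢within {s} {t} {u} {v} s≢t pₜ≡¬pₛ u≢v pᵥ≡pᵤ same =
    parity-clash (l s ∨ l t) (l u ∧ l v) same (loopCount-cross s≢t pₜ≡¬pₛ) (loopCount-within u≢v pᵥ≡pᵤ)

  loopCount-cross-injective : {s t u v : Fin N} → s ≢ t → p t ≡ not (p s) → u ≢ v → p v ≡ not (p u) →
    loopCount (F [ s ≔ t ]) ≡ loopCount (F [ u ≔ v ]) → (l s ∨ l t) ≡ (l u ∨ l v)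
  loopCount-cross-injective {s} {t} {u} {v} s≢t pₜ≡¬pₛ u≢v pᵥ≡¬pᵤ same =
    equal-totals⇒equal-bits (l s ∨ l t) (l u ∨ l v) same (loopCount-cross s≢t pₜ≡¬pₛ) (loopCount-cross u≢v pᵥ≡¬pᵤ)

  Twins : Fin N → Fin N → Set
  Twins x y = p x ≡ p y × l x ≡ l y

  F-resp-· : {x y : Fin N} → Twins x y → {a b : Fin N → Bool} →
    (∀ c → c x ≡ c y → c · a ≡ c · b) → F a ≡ F b
  F-resp-· (pₓ≡pᵧ , lₓ≡lᵧ) same-· = cong₂ _xor_ (cong₂ _∧_ (same-· p pₓ≡pᵧ) (same-· q (cong not pₓ≡pᵧ))) (same-· l lₓ≡lᵧ)

  identification-transpose : {x y s t s′ t′ : Fin N} → Twins x y →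
    transpose x y s ≡ s′ → transpose x y t ≡ t′ → (N , F [ s′ ≔ t′ ]) ≤ᶠ (N , F [ s ≔ t ])
  identification-transpose {x} {y} {s} {t} xy refl refl = τ , λ a → F-resp-· xy λ c cₓ≡cᵧ → begin
    c · (a ∘ identify (τ s) (τ t))                   ≡⟨ ·-identify c a (τ s) (τ t) ⟩
    c · a xor (c (τ s) ∧ (a (τ s) xor a (τ t)))      ≡⟨ cong₂ (λ u v → u xor (v ∧ (a (τ s) xor a (τ t))))
                                                              (·-transpose c a cₓ≡cᵧ) (sym (transpose-preserves c cₓ≡cᵧ s)) ⟨
    c · (a ∘ τ) xor (c s ∧ (a (τ s) xor a (τ t)))    ≡⟨ ·-identify c (a ∘ τ) s t ⟨
    c · (a ∘ τ ∘ identify s t)                       ∎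
    where
    open ≡-Reasoning
    τ : Fin N → Fin N
    τ = transpose x y

  identification-within-part : {i j w : Fin N} → Twins i j → i ≢ j → w ≢ j →
    (N , F [ i ≔ j ]) ≤ᶠ (N , F [ i ≔ w ])
  identification-within-part {i} {j} {w} ij i≢j w≢j = identify j w , λ a → F-resp-· ij λ c cᵢ≡cⱼ → begin
    c · (a ∘ identify i j)
      ≡⟨ ·-identify c a i j ⟩
    c · a xor (c i ∧ (a i xor a j))
      ≡⟨ solve 5 (λ C cᵢ aᵢ aⱼ a_w → C :+ (cᵢ :* (aᵢ :+ aⱼ)) := (C :+ (cᵢ :* (aⱼ :+ a_w))) :+ (cᵢ :* (aᵢ :+ a_w)))
                 refl (c · a) (c i) (a i) (a j) (a w) ⟩
    (c · a xor (c i ∧ (a j xor a w))) xor (c i ∧ (a i xor a w))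
      ≡⟨ cong (λ z → (c · a xor (z ∧ (a j xor a w))) xor (c i ∧ (a i xor a w))) cᵢ≡cⱼ ⟩
    (c · a xor (c j ∧ (a j xor a w))) xor (c i ∧ (a i xor a w))
      ≡⟨ cong₂ (λ u v → u xor (c i ∧ v)) (·-identify c a j w) (cong₂ (λ u v → a u xor a v) (identify-other i≢j) (identify-other w≢j)) ⟨
    c · (a ∘ identify j w) xor (c i ∧ (a (identify j w i) xor a (identify j w w)))
      ≡⟨ ·-identify c (a ∘ identify j w) i w ⟨
    c · (a ∘ identify j w ∘ identify i w)
      ∎
    where open ≡-Reasoning

  parts-differ : ∀ {x y} → p x ≡ true → p y ≡ false → x ≢ y
  parts-differ pₓ pᵧ refl = case trans (sym pₓ) pᵧ of λ ()

  LoopsConstantOnParts : Set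
  LoopsConstantOnParts = ∀ i j → p i ≡ p j → l i ≡ l j

  module _ {a₀ b₀ : Fin N} (pa₀ : p a₀ ≡ true) (pb₀ : p b₀ ≡ false) where

    opposite : ∀ y → ∃ λ w → p w ≡ not (p y)
    opposite y with p y
    ... | true  = b₀ , pb₀
    ... | false = a₀ , pa₀

    pb₀≡¬pa₀ : p b₀ ≡ not (p a₀)
    pb₀≡¬pa₀ = trans pb₀ (cong not (sym pa₀))

    a₀≢b₀ : a₀ ≢ b₀
    a₀≢b₀ = opposite⇒distinct pb₀≡¬pa₀

    identification-proper : {s t : Fin N} → s ≢ t → (N , F [ s ≔ t ]) <ᶠ (N , F)
    identification-proper s≢t =
      (identify _ _ , λ _ → refl) , essential⇒not-below-identification F-cong (λ y → F-essential (proj₂ (opposite y))) s≢t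

    module _ (constant : LoopsConstantOnParts) where

      twins : ∀ {x y} → p x ≡ p y → Twins x y
      twins pₓ≡pᵧ = pₓ≡pᵧ , constant _ _ pₓ≡pᵧ

      below-oriented-identification : ∀ {i j} → p i ≡ true → p j ≡ false → i ≢ j →
        (N , F [ i ≔ j ]) ≤ᶠ (N , F [ a₀ ≔ b₀ ])
      below-oriented-identification {i} {j} pᵢ pⱼ i≢j = begin
        (N , F [ i ≔ j ])     ≲⟨ identification-transpose (twins (trans pa₀ (sym pᵢ))) (transpose-left a₀ i)
                                                          (transpose-other (parts-differ pa₀ pⱼ ∘ sym) (i≢j ∘ sym)) ⟩
        (N , F [ a₀ ≔ j ])    ≲⟨ identification-transpose (twins (trans pb₀ (sym pⱼ)))
                                                          (transpose-other a₀≢b₀ (parts-differ pa₀ pⱼ)) (transpose-left b₀ j) ⟩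
        (N , F [ a₀ ≔ b₀ ])   ∎
        where open PreorderReasoning ≤ᶠ-preorder

      below-cross-identification : {i j : Fin N} → i ≢ j → (N , F [ i ≔ j ]) ≤ᶠ (N , F [ a₀ ≔ b₀ ])
      below-cross-identification {i} {j} i≢j with p i in pᵢ | p j in pⱼ
      ... | true  | false = below-oriented-identification pᵢ pⱼ i≢j
      ... | false | true  = begin
        (N , F [ i ≔ j ])     ≲⟨ identification-swap F-cong i≢j ⟩
        (N , F [ j ≔ i ])     ≲⟨ below-oriented-identification pⱼ pᵢ (i≢j ∘ sym) ⟩
        (N , F [ a₀ ≔ b₀ ])   ∎
        where open PreorderReasoning ≤ᶠ-preorder
      ... | true  | true  = begin
        (N , F [ i ≔ j ])     ≲⟨ identification-within-part (twins (trans pᵢ (sym pⱼ))) i≢j (parts-differ pⱼ pb₀ ∘ sym) ⟩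
        (N , F [ i ≔ b₀ ])    ≲⟨ below-oriented-identification pᵢ pb₀ (parts-differ pᵢ pb₀) ⟩
        (N , F [ a₀ ≔ b₀ ])   ∎
        where open PreorderReasoning ≤ᶠ-preorder
      ... | false | false = begin
        (N , F [ i ≔ j ])     ≲⟨ identification-within-part (twins (trans pᵢ (sym pⱼ))) i≢j (parts-differ pa₀ pⱼ) ⟩
        (N , F [ i ≔ a₀ ])    ≲⟨ identification-swap F-cong (parts-differ pa₀ pᵢ ∘ sym) ⟩
        (N , F [ a₀ ≔ i ])    ≲⟨ below-oriented-identification pa₀ pᵢ (parts-differ pa₀ pᵢ) ⟩
        (N , F [ a₀ ≔ b₀ ])   ∎
        where open PreorderReasoning ≤ᶠ-preorder

    joinIrreducible-if : LoopsConstantOnParts → JoinIrreducible (N , F)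
    joinIrreducible-if constant = (N , F [ a₀ ≔ b₀ ]) , identification-proper a₀≢b₀ , maximal
      where
      maximal : ∀ g → g <ᶠ (N , F) → g ≤ᶠ (N , F [ a₀ ≔ b₀ ])
      maximal g g<F with proper-minor⇒below-identification F-cong a₀ g<F
      ... | s , t , s≢t , g≤Fst = ≤ᶠ-trans {g} {N , F [ s ≔ t ]} {N , F [ a₀ ≔ b₀ ]} g≤Fst (below-cross-identification constant s≢t)

    module _ {i j : Fin N} (pᵢ≡pⱼ : p i ≡ p j) (lᵢ : l i ≡ true) (lⱼ : l j ≡ false) where

      i≢j : i ≢ j
      i≢j refl = case trans (sym lᵢ) lⱼ of λ ()

      avoiding-vertex : {s t : Fin N} → p t ≡ not (p s) → ∃ λ w → w ≢ s × w ≢ t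
      avoiding-vertex {s} {t} pₜ≡¬pₛ with i ≟ s | i ≟ t
      ... | yes refl | _        = j , i≢j ∘ sym , opposite⇒distinct (trans pₜ≡¬pₛ (cong not pᵢ≡pⱼ))
      ... | no _     | yes refl = j , opposite⇒distinct (trans (sym pᵢ≡pⱼ) pₜ≡¬pₛ) ∘ sym , i≢j ∘ sym
      ... | no i≢s   | no i≢t   = i , i≢s , i≢t

      cross-essential : {s t : Fin N} → s ≢ t → p t ≡ not (p s) → ∀ y → y ≢ s → Essential (F [ s ≔ t ]) y
      cross-essential s≢t pₜ≡¬pₛ with avoiding-vertex pₜ≡¬pₛ
      ... | w , w≢s , w≢t = cross-identification-essential s≢t pₜ≡¬pₛ w w≢s w≢t

      Distinguishing : Fin N → Fin N → Set
      Distinguishing u v = ∃₂ λ s t → s ≢ t × (∀ y → y ≢ s → Essential (F [ s ≔ t ]) y) ×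
                                       loopCount (F [ s ≔ t ]) ≢ loopCount (F [ u ≔ v ])

      distinguishing-identification : {u v : Fin N} → u ≢ v → Distinguishing u v
      distinguishing-identification {u} {v} u≢v with p v ≟ᵇ p u
      ... | yes pᵥ≡pᵤ =
        a₀ , b₀ , a₀≢b₀ , cross-essential a₀≢b₀ pb₀≡¬pa₀ , loopCount-cross≢within a₀≢b₀ pb₀≡¬pa₀ u≢v pᵥ≡pᵤ
      ... | no pᵥ≢pᵤ with l u ∨ l v in lᵤ∨lᵥ
      ...   | false with opposite i
      ...     | o , pₒ = i , o , opposite⇒distinct pₒ , cross-essential (opposite⇒distinct pₒ) pₒ , λ same →
        case trans (cong (_∨ l o) (sym lᵢ))
                   (trans (loopCount-cross-injective (opposite⇒distinct pₒ) pₒ u≢v (¬-not pᵥ≢pᵤ) same) lᵤ∨lᵥ) of λ ()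
      distinguishing-identification {u} {v} u≢v | no pᵥ≢pᵤ | true
        with any? (λ x → (p x ≟ᵇ not (p j)) ×-dec (l x ≟ᵇ false))
      ... | yes (o , pₒ , lₒ) = j , o , opposite⇒distinct pₒ , cross-essential (opposite⇒distinct pₒ) pₒ , λ same →
        case trans (cong₂ _∨_ (sym lⱼ) (sym lₒ))
                   (trans (loopCount-cross-injective (opposite⇒distinct pₒ) pₒ u≢v (¬-not pᵥ≢pᵤ) same) lᵤ∨lᵥ) of λ ()
      ... | no unlooped-opposite with opposite i
      ...   | o , pₒ =
        i , j , i≢j , within-identification-essential i≢j (sym pᵢ≡pⱼ) (trans lⱼ (cong not (sym lᵢ))) looped pₒ ,
        loopCount-cross≢within u≢v (¬-not pᵥ≢pᵤ) i≢j (sym pᵢ≡pⱼ) ∘ sym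
        where
        looped : ∀ x → p x ≡ not (p i) → l x ≡ true
        looped x pₓ with l x ≟ᵇ false
        ... | yes lₓ = ⊥-elim (unlooped-opposite (x , trans pₓ (cong not pᵢ≡pⱼ) , lₓ))
        ... | no lₓ  = ¬-not lₓ

      not-joinIrreducible : ¬ JoinIrreducible (N , F)
      not-joinIrreducible (f′ , f′<F , maximal) with proper-minor⇒below-identification F-cong a₀ f′<F
      ... | u , v , u≢v , f′≤Fuv with distinguishing-identification u≢v
      ...   | s , t , s≢t , essential , counts-differ
        with ≤ᶠ-trans {N , F [ s ≔ t ]} {f′} {N , F [ u ≔ v ]} (maximal _ (identification-proper s≢t)) f′≤Fuv
      ...     | π , Fst≡Fuv∘π = counts-differ (loopCount-invariant π Fst≡Fuv∘π (identification-ignores-source F-cong u≢v) essential)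

    joinIrreducible-onlyIf : JoinIrreducible (N , F) → LoopsConstantOnParts
    joinIrreducible-onlyIf irreducible i j pᵢ≡pⱼ with l i in lᵢ | l j in lⱼ
    ... | false | false = refl
    ... | true  | true  = refl
    ... | true  | false = ⊥-elim (not-joinIrreducible pᵢ≡pⱼ lᵢ lⱼ irreducible)
    ... | false | true  = ⊥-elim (not-joinIrreducible (sym pᵢ≡pⱼ) lⱼ lᵢ irreducible)

-- The function of the graph

xorSum-bipartite-pairs : (p x : Fin N → Bool) (e : Fin N → Fin N → Bool) → (∀ i j → e i j ≡ p i xor p j) →
  xorSum (λ i → xorSum (λ j → (toℕ i <ᵇ toℕ j) ∧ e i j ∧ x i ∧ x j)) ≡ p · x ∧ (not ∘ p) · x
xorSum-bipartite-pairs {zero}  p x e e≡p⊕p = refl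
xorSum-bipartite-pairs {suc N} p x e e≡p⊕p = begin
  xorSum (λ j → e fzero (fsuc j) ∧ x₀ ∧ x (fsuc j))
    xor xorSum (λ i → xorSum (λ j → (toℕ i <ᵇ toℕ j) ∧ e (fsuc i) (fsuc j) ∧ x (fsuc i) ∧ x (fsuc j)))
    ≡⟨ cong₂ _xor_ first-row
                   (xorSum-bipartite-pairs (p ∘ fsuc) (x ∘ fsuc) (λ i j → e (fsuc i) (fsuc j)) (λ i j → e≡p⊕p (fsuc i) (fsuc j))) ⟩
  (((x₀ ∧ p₀) ∧ Q) xor ((x₀ ∧ not p₀) ∧ P)) xor (P ∧ Q)
    ≡⟨ expand p₀ ⟩
  ((p₀ ∧ x₀) xor P) ∧ ((not p₀ ∧ x₀) xor Q)
    ∎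
  where
  open ≡-Reasoning
  x₀ p₀ P Q : Bool
  x₀ = x fzero
  p₀ = p fzero
  P = (p ∘ fsuc) · (x ∘ fsuc)
  Q = (not ∘ p ∘ fsuc) · (x ∘ fsuc)
  first-row : xorSum (λ j → e fzero (fsuc j) ∧ x₀ ∧ x (fsuc j)) ≡ ((x₀ ∧ p₀) ∧ Q) xor ((x₀ ∧ not p₀) ∧ P)
  first-row = begin
    xorSum (λ j → e fzero (fsuc j) ∧ x₀ ∧ x (fsuc j))
      ≡⟨ xorSum-cong (λ j → trans (cong (_∧ (x₀ ∧ x (fsuc j))) (e≡p⊕p fzero (fsuc j)))
                                   (solve 4 (λ x₀ p₀ pⱼ xⱼ → (p₀ :+ pⱼ) :* (x₀ :* xⱼ)
                                            := ((x₀ :* p₀) :* ((con true :+ pⱼ) :* xⱼ)) :+ ((x₀ :* (con true :+ p₀)) :* (pⱼ :* xⱼ)))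
                                          refl x₀ p₀ (p (fsuc j)) (x (fsuc j)))) ⟩
    xorSum (λ j → ((x₀ ∧ p₀) ∧ (not (p (fsuc j)) ∧ x (fsuc j))) xor ((x₀ ∧ not p₀) ∧ (p (fsuc j) ∧ x (fsuc j))))
      ≡⟨ xorSum-xor (λ j → (x₀ ∧ p₀) ∧ (not (p (fsuc j)) ∧ x (fsuc j))) (λ j → (x₀ ∧ not p₀) ∧ (p (fsuc j) ∧ x (fsuc j))) ⟩
    xorSum (λ j → (x₀ ∧ p₀) ∧ (not (p (fsuc j)) ∧ x (fsuc j))) xor xorSum (λ j → (x₀ ∧ not p₀) ∧ (p (fsuc j) ∧ x (fsuc j)))
      ≡⟨ cong₂ _xor_ (xorSum-scale (x₀ ∧ p₀) (λ j → not (p (fsuc j)) ∧ x (fsuc j)))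
                     (xorSum-scale (x₀ ∧ not p₀) (λ j → p (fsuc j) ∧ x (fsuc j))) ⟩
    ((x₀ ∧ p₀) ∧ Q) xor ((x₀ ∧ not p₀) ∧ P)
      ∎
  -- Split on p₀: the ring solver does not know that p₀ ∧ not p₀ ≡ false.
  expand : ∀ p₀ → (((x₀ ∧ p₀) ∧ Q) xor ((x₀ ∧ not p₀) ∧ P)) xor (P ∧ Q) ≡ ((p₀ ∧ x₀) xor P) ∧ ((not p₀ ∧ x₀) xor Q)
  expand false = solve 3 (λ x₀ P Q → ((x₀ :* con false) :* Q :+ (x₀ :* con true) :* P) :+ (P :* Q) := P :* (x₀ :+ Q)) refl x₀ P Q
  expand true  = solve 3 (λ x₀ P Q → ((x₀ :* con true) :* Q :+ (x₀ :* con false) :* P) :+ (P :* Q) := (x₀ :+ P) :* Q) refl x₀ P Q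

member : (Q : Subset N) → ∣ Q ∣ ≥ 1 → ∃ λ x → lookup Q x ≡ true
member {N} Q ∣Q∣≥1 with nonempty? Q
... | yes (x , x∈Q) = x , []=⇒lookup x∈Q
... | no empty = ⊥-elim (ℕ.1+n≰n (subst (1 ≤_) (trans (cong ∣_∣ (Empty-unique empty)) (∣⊥∣≡0 N)) ∣Q∣≥1))

fG-bipartite : (G : Graph N) (P : Subset N) → (∀ i j → i ≢ j → edge G i j ≡ lookup P i xor lookup P j) →
  ∀ a → proj₂ (fG G) a ≡ Bipartite.F (lookup P) (loop G) a
fG-bipartite G P edges a =
  trans (cong (loop G · a xor_) (xorSum-bipartite-pairs (lookup P) a (edge G) complete-bipartite)) (xor-comm (loop G · a) _)
  where
  complete-bipartite : ∀ i j → edge G i j ≡ lookup P i xor lookup P j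
  complete-bipartite i j with i ≟ j
  ... | yes refl = trans (edge-irref G i) (sym (xor-same (lookup P i)))
  ... | no i≢j   = edges i j i≢j

proposition4p16 : (n m N : ℕ) → n ≥ 1 → m ≥ 1 → (G : Graph N) →
    (P : Subset N) → ∣ P ∣ ≡ n → ∣ ∁ P ∣ ≡ m →
    (∀ (i j : Fin N) → i ≢ j → edge G i j ≡ (lookup P i xor lookup P j)) →
    JoinIrreducibleGraph G ⇔
      (∀ (i j : Fin N) → lookup P i ≡ lookup P j → loop G i ≡ loop G j)
proposition4p16 n m N n≥1 m≥1 G P ∣P∣≡n ∣∁P∣≡m edges =
  mk⇔ (joinIrreducible-onlyIf pa₀ pb₀ ∘ JoinIrreducible-resp fG≡F)
      (JoinIrreducible-resp (sym ∘ fG≡F) ∘ joinIrreducible-if pa₀ pb₀)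
  where
  open Bipartite (lookup P) (loop G)
  fG≡F : ∀ a → proj₂ (fG G) a ≡ F a
  fG≡F = fG-bipartite G P edges
  a₀-in-P : ∃ λ x → lookup P x ≡ true
  a₀-in-P = member P (subst (_≥ 1) (sym ∣P∣≡n) n≥1)
  b₀-in-∁P : ∃ λ x → lookup (∁ P) x ≡ true
  b₀-in-∁P = member (∁ P) (subst (_≥ 1) (sym ∣∁P∣≡m) m≥1)
  pa₀ : lookup P (proj₁ a₀-in-P) ≡ true
  pa₀ = proj₂ a₀-in-P
  pb₀ : lookup P (proj₁ b₀-in-∁P) ≡ false
  pb₀ = trans (sym (not-involutive _)) (cong not (trans (sym (lookup-map (proj₁ b₀-in-∁P) not P)) (proj₂ b₀-in-∁P)))
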